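{- Let $\alpha\neq0$ and let $\beta,\gamma_1,\gamma_2,\lambda_1,\lambda_2$ be real or complex numbers. For every integer $n\ge0$, $$\sum_{k=0}^{n}\binom{n}{k}\mathcal{E}^{(\lambda_1)}_k(\alpha,\beta,\alpha+\gamma_1-\beta)\,\mathcal{E}^{(\lambda_2)}_{n-k}(\alpha,\beta,\gamma_2)=\mathcal{E}^{(\lambda_1+\lambda_2)}_n(\alpha,\beta,\alpha+\gamma_1+\gamma_2-\beta).$$
   Context: The higher order generalised Euler polynomials $\mathcal{E}^{(\lambda)}_n(\alpha,\beta,x)$ are defined (for $\alpha\neq0$) by the formal power series identity $$\Big[\frac{2}{(1+\alpha t)^{\beta/\alpha}+1}\Big]^{\lambda}(1+\alpha t)^{x/\alpha}=\sum_{n\ge0}\mathcal{E}^{(\lambda)}_n(\alpha,\beta,x)\frac{t^n}{n!},$$ where $(1+\alpha t)^c=\sum_{j\ge0}\binom{c}{j}(\alpha t)^j$. -}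

module Defs where

open import Level using (_⊔_) renaming (suc to lsuc)
open import Data.Nat using (ℕ; zero; suc; _∸_; _!)
open import Algebra.Bundles using (CommutativeRing)
open import Relation.Nullary using (¬_)

-- A field of characteristic zero (covers ℝ and ℂ), given as a commutative
-- ring (with setoid equality ≈) together with an inverse operation that is
-- a two-sided inverse on nonzero elements, and ℕ-casts of positive numbers ≉ 0.
-- cast ℕ → Carrier of a commutative ring
ringFromℕ : ∀ {c ℓ} (R : CommutativeRing c ℓ) → ℕ → CommutativeRing.Carrier R
ringFromℕ R zero = CommutativeRing.0# R
ringFromℕ R (suc n) = CommutativeRing._+_ R (CommutativeRing.1# R) (ringFromℕ R n)

record CharZeroField c ℓ : Set (lsuc (c ⊔ ℓ)) where
  field
    cring : CommutativeRing c ℓ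
  open CommutativeRing cring public
  field
    _⁻¹ : Carrier → Carrier
    ⁻¹-inverse : ∀ x → ¬ (x ≈ 0#) → x * (x ⁻¹) ≈ 1#
    charZero : ∀ n → ¬ (ringFromℕ cring (suc n) ≈ 0#)

module Euler {c ℓ} (F : CharZeroField c ℓ) where
  open CharZeroField F

  fromℕ : ℕ → Carrier
  fromℕ = ringFromℕ cring

  Σ< : ℕ → (ℕ → Carrier) → Carrier
  Σ< zero f = 0#
  Σ< (suc n) f = Σ< n f + f n

  Π< : ℕ → (ℕ → Carrier) → Carrier
  Π< zero f = 1#
  Π< (suc n) f = Π< n f * f n

  pow : Carrier → ℕ → Carrier
  pow x zero = 1#
  pow x (suc n) = pow x n * x

  gbinom : Carrier → ℕ → Carrier
  gbinom a j = Π< j (λ i → a - fromℕ i) * (fromℕ (j !)) ⁻¹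

  -- formal power series, as coefficient sequences (ordinary coefficients)
  Series : Set c
  Series = ℕ → Carrier

  one : Series
  one zero = 1#
  one (suc _) = 0#

  _⊕_ : Series → Series → Series
  (f ⊕ g) n = f n + g n

  _⊖_ : Series → Series → Series
  (f ⊖ g) n = f n - g n

  scale : Carrier → Series → Series
  scale a f n = a * f n

  _⊛_ : Series → Series → Series
  (f ⊛ g) n = Σ< (suc n) (λ k → f k * g (n ∸ k))

  spow : Series → ℕ → Series
  spow w zero = one
  spow w (suc m) = spow w m ⊛ w

  -- Σ_m a_m w^m for a series w with zero constant term
  -- (the n-th coefficient only involves m ≤ n)
  subst : (ℕ → Carrier) → Series → Series
  subst a w n = Σ< (suc n) (λ m → a m * spow w m n)

  -- reciprocal of a series g with constant term 1:  1/g = Σ_m (1 - g)^m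
  recip : Series → Series
  recip g = subst (λ _ → 1#) (one ⊖ g)

  -- g^λ for a series g with constant term 1:  Σ_m binom(λ, m) (g - 1)^m
  gpow : Series → Carrier → Series
  gpow g λ' = subst (gbinom λ') (g ⊖ one)

  -- (1 + α t)^{c/α} = Σ_j binom(c/α, j) (α t)^j
  onePlusPow : Carrier → Carrier → Series
  onePlusPow α c j = gbinom (c * (α ⁻¹)) j * pow α j

  -- generating function [2 / ((1+αt)^{β/α} + 1)]^λ (1+αt)^{x/α}
  genFun : Carrier → Carrier → Carrier → Carrier → Series
  genFun λ' α β x =
    gpow (recip (scale ((fromℕ 2) ⁻¹) (onePlusPow α β ⊕ one))) λ' ⊛ onePlusPow α x

  E : Carrier → Carrier → Carrier → Carrier → ℕ → Carrier
  E λ' α β x n = fromℕ (n !) * genFun λ' α β x n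

module Submission where

-- Write G(λ,x) for the generating series of E^{(λ)}_n(α,β,x), so that
-- E^{(λ)}_n = n! · [tⁿ] G(λ,x).  Since C(n,k) k! (n-k)! = n!, the left-hand
-- side of the theorem is n! times the n-th coefficient of the Cauchy product
-- G(λ₁,x₁) ⊛ G(λ₂,γ₂), with x₁ = α + γ₁ - β.  The theorem therefore follows
-- from the product law  G(λ₁,x) ⊛ G(λ₂,y) = G(λ₁+λ₂, x+y),  which in turn is
-- the combination of two exponential laws:
--   (1+αt)^{x/α} (1+αt)^{y/α} = (1+αt)^{(x+y)/α}   and   g^{λ₁} g^{λ₂} = g^{λ₁+λ₂}.
-- Both reduce to the Chu–Vandermonde identity  Σ_k C(a,k) C(b,m-k) = C(a+b,m)
-- for generalised binomial coefficients, proved by induction on m from the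
-- recurrence (m+1) C(a,m+1) = (a-m) C(a,m).  For the second law we also need
-- that substituting a series w with zero constant term is multiplicative:
-- (Σ aₘ wᵐ)(Σ bₘ wᵐ) = Σ (a⊛b)ₘ wᵐ.

open import Level using (Level)
open import Data.Nat as ℕ using (ℕ; zero; suc; _≤_; _<_; z≤n; s≤s; _∸_; _!)
import Data.Nat.Properties as ℕP
open import Data.Nat.Combinatorics using (_C_; nCk≡n!/k![n-k]!; k![n∸k]!∣n!)
open import Data.Nat.DivMod using (m/n*n≡m)
open import Data.Sum using (inj₁; inj₂)
open import Relation.Binary.PropositionalEquality as P using (_≡_)
open import Relation.Nullary using (¬_; yes; no)
open import Defs

binomial-factorials : ∀ n k → k ≤ n → (n C k) ℕ.* (k ! ℕ.* (n ∸ k) !) ≡ n !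
binomial-factorials n k k≤n =
  P.trans (P.cong (ℕ._* (k ! ℕ.* (n ∸ k) !)) (nCk≡n!/k![n-k]! k≤n))
          (m/n*n≡m (k![n∸k]!∣n! k≤n))
  where instance _ = k ℕP.!* (n ∸ k) !≢0

module EulerConvolution {c ℓ} (F : CharZeroField c ℓ) where
  open CharZeroField F
  open Euler F
  open import Relation.Binary.Reasoning.Setoid setoid
  open import Algebra.Properties.AbelianGroup +-abelianGroup using (⁻¹-∙-comm)

  -- Commutative-semiring normalisation; the few identities involving
  -- subtraction are reduced to it by treating negated terms as atoms.
  open import Algebra.Solver.Ring.NaturalCoefficients.Default commutativeSemiring
    using (solve; _:=_; _:+_; _:*_)

  ≡-cong : ∀ {A : Set} (f : A → Carrier) {i j : A} → i ≡ j → f i ≈ f j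
  ≡-cong f eq = reflexive (P.cong f eq)

  fromℕ-+ : ∀ m n → fromℕ (m ℕ.+ n) ≈ fromℕ m + fromℕ n
  fromℕ-+ zero n = sym (+-identityˡ _)
  fromℕ-+ (suc m) n = trans (+-congˡ (fromℕ-+ m n)) (sym (+-assoc _ _ _))

  fromℕ-* : ∀ m n → fromℕ (m ℕ.* n) ≈ fromℕ m * fromℕ n
  fromℕ-* zero n = sym (zeroˡ _)
  fromℕ-* (suc m) n = begin
    fromℕ (n ℕ.+ m ℕ.* n)             ≈⟨ fromℕ-+ n (m ℕ.* n) ⟩
    fromℕ n + fromℕ (m ℕ.* n)         ≈⟨ +-cong (sym (*-identityˡ _)) (fromℕ-* m n) ⟩
    1# * fromℕ n + fromℕ m * fromℕ n  ≈⟨ sym (distribʳ _ _ _) ⟩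
    (1# + fromℕ m) * fromℕ n          ∎

  fromℕ-split : ∀ k M → k ≤ M → fromℕ M ≈ fromℕ k + fromℕ (M ∸ k)
  fromℕ-split k M k≤M =
    trans (≡-cong fromℕ (P.sym (ℕP.m+[n∸m]≡n k≤M))) (fromℕ-+ k (M ∸ k))

  fromℕ-nonzero : ∀ n → .{{ℕ.NonZero n}} → ¬ (fromℕ n ≈ 0#)
  fromℕ-nonzero (suc k) = charZero k

  factorial-nonzero : ∀ m → ¬ (fromℕ (m !) ≈ 0#)
  factorial-nonzero m = fromℕ-nonzero (m !) {{m ℕP.!≢0}}

  inverse-unique : ∀ x y → ¬ (x ≈ 0#) → x * y ≈ 1# → y ≈ x ⁻¹
  inverse-unique x y x≉0 xy≈1 = begin
    y               ≈⟨ sym (*-identityʳ y) ⟩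
    y * 1#          ≈⟨ *-congˡ (sym (⁻¹-inverse x x≉0)) ⟩
    y * (x * x ⁻¹)  ≈⟨ solve 3 (λ X Y Z → Y :* (X :* Z) := (X :* Y) :* Z) refl x y (x ⁻¹) ⟩
    (x * y) * x ⁻¹  ≈⟨ *-congʳ xy≈1 ⟩
    1# * x ⁻¹       ≈⟨ *-identityˡ _ ⟩
    x ⁻¹            ∎

  *-cancelʳ : ∀ s x y → ¬ (s ≈ 0#) → x * s ≈ y * s → x ≈ y
  *-cancelʳ s x y s≉0 xs≈ys = begin
    x                ≈⟨ sym (*-identityʳ x) ⟩
    x * 1#           ≈⟨ *-congˡ (sym (⁻¹-inverse s s≉0)) ⟩
    x * (s * s ⁻¹)   ≈⟨ sym (*-assoc _ _ _) ⟩
    (x * s) * s ⁻¹   ≈⟨ *-congʳ xs≈ys ⟩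
    (y * s) * s ⁻¹   ≈⟨ *-assoc _ _ _ ⟩
    y * (s * s ⁻¹)   ≈⟨ *-congˡ (⁻¹-inverse s s≉0) ⟩
    y * 1#           ≈⟨ *-identityʳ y ⟩
    y                ∎

  Σ-cong : ∀ n {f g : ℕ → Carrier} → (∀ i → i < n → f i ≈ g i) → Σ< n f ≈ Σ< n g
  Σ-cong zero f≈g = refl
  Σ-cong (suc n) f≈g = +-cong (Σ-cong n (λ i i<n → f≈g i (ℕP.m≤n⇒m≤1+n i<n))) (f≈g n ℕP.≤-refl)

  Σ-cong-∀ : ∀ n {f g : ℕ → Carrier} → (∀ i → f i ≈ g i) → Σ< n f ≈ Σ< n g
  Σ-cong-∀ n f≈g = Σ-cong n (λ i _ → f≈g i)

  Σ-zero : ∀ n (f : ℕ → Carrier) → (∀ i → i < n → f i ≈ 0#) → Σ< n f ≈ 0#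
  Σ-zero zero f f≈0 = refl
  Σ-zero (suc n) f f≈0 =
    trans (+-cong (Σ-zero n f (λ i i<n → f≈0 i (ℕP.m≤n⇒m≤1+n i<n))) (f≈0 n ℕP.≤-refl)) (+-identityʳ _)

  Σ-+ : ∀ n (f g : ℕ → Carrier) → Σ< n (λ i → f i + g i) ≈ Σ< n f + Σ< n g
  Σ-+ zero f g = sym (+-identityˡ _)
  Σ-+ (suc n) f g = begin
    Σ< n (λ i → f i + g i) + (f n + g n)  ≈⟨ +-congʳ (Σ-+ n f g) ⟩
    (Σ< n f + Σ< n g) + (f n + g n)
      ≈⟨ solve 4 (λ a b c d → (a :+ b) :+ (c :+ d) := (a :+ c) :+ (b :+ d)) refl (Σ< n f) (Σ< n g) (f n) (g n) ⟩
    (Σ< n f + f n) + (Σ< n g + g n)       ∎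

  Σ-*ˡ : ∀ n x (f : ℕ → Carrier) → x * Σ< n f ≈ Σ< n (λ i → x * f i)
  Σ-*ˡ zero x f = zeroʳ x
  Σ-*ˡ (suc n) x f = trans (distribˡ _ _ _) (+-congʳ (Σ-*ˡ n x f))

  Σ-*ʳ : ∀ n x (f : ℕ → Carrier) → Σ< n f * x ≈ Σ< n (λ i → f i * x)
  Σ-*ʳ zero x f = zeroˡ x
  Σ-*ʳ (suc n) x f = trans (distribʳ _ _ _) (+-congʳ (Σ-*ʳ n x f))

  Σ-*-Σ : ∀ p q (f g : ℕ → Carrier) → Σ< p f * Σ< q g ≈ Σ< p (λ i → Σ< q (λ j → f i * g j))
  Σ-*-Σ p q f g = trans (Σ-*ʳ p _ f) (Σ-cong-∀ p (λ i → Σ-*ˡ q (f i) g))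

  Σ-head : ∀ n (f : ℕ → Carrier) → Σ< (suc n) f ≈ f 0 + Σ< n (λ i → f (suc i))
  Σ-head zero f = trans (+-identityˡ _) (sym (+-identityʳ _))
  Σ-head (suc n) f = trans (+-congʳ (Σ-head n f)) (+-assoc _ _ _)

  Σ-truncate : ∀ {m} n (f : ℕ → Carrier) → m ≤ n →
    (∀ i → m ≤ i → i < n → f i ≈ 0#) → Σ< n f ≈ Σ< m f
  Σ-truncate zero f z≤n _ = refl
  Σ-truncate (suc n) f m≤1+n f≈0 with ℕP.m≤n⇒m<n∨m≡n m≤1+n
  ... | inj₂ P.refl = refl
  ... | inj₁ (s≤s m≤n) = trans
    (+-cong (Σ-truncate n f m≤n (λ i m≤i i<n → f≈0 i m≤i (ℕP.m≤n⇒m≤1+n i<n))) (f≈0 n m≤n ℕP.≤-refl))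
    (+-identityʳ _)

  Σ-swap : ∀ a b (h : ℕ → ℕ → Carrier) →
    Σ< a (λ i → Σ< b (h i)) ≈ Σ< b (λ j → Σ< a (λ i → h i j))
  Σ-swap zero b h = sym (Σ-zero b _ (λ _ _ → refl))
  Σ-swap (suc a) b h = begin
    Σ< a (λ i → Σ< b (h i)) + Σ< b (h a)              ≈⟨ +-congʳ (Σ-swap a b h) ⟩
    Σ< b (λ j → Σ< a (λ i → h i j)) + Σ< b (h a)      ≈⟨ sym (Σ-+ b _ _) ⟩
    Σ< b (λ j → Σ< a (λ i → h i j) + h a j)           ∎

  ∸-suc : ∀ n i → i < n → n ∸ i ≡ suc (n ∸ suc i)
  ∸-suc (suc n) zero _ = P.refl
  ∸-suc (suc n) (suc i) (s≤s i<n) = ∸-suc n i i<n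

  Σ-reverse : ∀ n (f : ℕ → Carrier) → Σ< n f ≈ Σ< n (λ i → f (n ∸ suc i))
  Σ-reverse zero f = refl
  Σ-reverse (suc n) f = begin
    Σ< (suc n) f                                  ≈⟨ Σ-head n f ⟩
    f 0 + Σ< n (λ i → f (suc i))                  ≈⟨ +-congˡ (Σ-reverse n (λ i → f (suc i))) ⟩
    f 0 + Σ< n (λ i → f (suc (n ∸ suc i)))        ≈⟨ +-comm _ _ ⟩
    Σ< n (λ i → f (suc (n ∸ suc i))) + f 0
      ≈⟨ +-cong (Σ-cong n (λ i i<n → ≡-cong f (P.sym (∸-suc n i i<n)))) (≡-cong f (P.sym (ℕP.n∸n≡0 n))) ⟩
    Σ< n (λ i → f (n ∸ i)) + f (n ∸ n)            ∎

  Σ-triangle : ∀ N (h : ℕ → ℕ → Carrier) →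
    Σ< N (λ i → Σ< (suc i) (h i)) ≈ Σ< N (λ j → Σ< (N ∸ j) (λ l → h (j ℕ.+ l) j))
  Σ-triangle zero h = refl
  Σ-triangle (suc N) h = begin
    Σ< N (λ i → Σ< (suc i) (h i)) + Σ< (suc N) (h N)   ≈⟨ +-congʳ (Σ-triangle N h) ⟩
    Σ< N column + Σ< (suc N) (h N)
      ≈⟨ +-congʳ (sym (trans (+-congˡ (≡-cong (λ k → Σ< k (λ l → h (N ℕ.+ l) N)) (ℕP.n∸n≡0 N))) (+-identityʳ _))) ⟩
    Σ< (suc N) column + Σ< (suc N) (h N)               ≈⟨ sym (Σ-+ (suc N) _ _) ⟩
    Σ< (suc N) (λ j → column j + h N j)                ≈⟨ Σ-cong (suc N) extend-column ⟩
    Σ< (suc N) (λ j → Σ< (suc N ∸ j) (λ l → h (j ℕ.+ l) j)) ∎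
    where
    column : ℕ → Carrier
    column j = Σ< (N ∸ j) (λ l → h (j ℕ.+ l) j)
    extend-column : ∀ j → j < suc N → column j + h N j ≈ Σ< (suc N ∸ j) (λ l → h (j ℕ.+ l) j)
    extend-column j (s≤s j≤N) = sym (trans
      (≡-cong (λ k → Σ< k (λ l → h (j ℕ.+ l) j)) (ℕP.+-∸-assoc 1 j≤N))
      (+-congˡ (≡-cong (λ k → h k j) (ℕP.m+[n∸m]≡n j≤N))))

  infix 4 _≋_
  _≋_ : Series → Series → Set ℓ
  f ≋ g = ∀ n → f n ≈ g n

  ≋-refl : ∀ {f} → f ≋ f
  ≋-refl _ = refl

  ≋-sym : ∀ {f g} → f ≋ g → g ≋ f
  ≋-sym f≋g n = sym (f≋g n)

  ≋-trans : ∀ {f g h} → f ≋ g → g ≋ h → f ≋ h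
  ≋-trans f≋g g≋h n = trans (f≋g n) (g≋h n)

  ⊛-cong : ∀ {f f′ g g′} → f ≋ f′ → g ≋ g′ → (f ⊛ g) ≋ (f′ ⊛ g′)
  ⊛-cong f≋f′ g≋g′ n = Σ-cong-∀ (suc n) (λ k → *-cong (f≋f′ k) (g≋g′ (n ∸ k)))

  ⊛-comm : ∀ f g → (f ⊛ g) ≋ (g ⊛ f)
  ⊛-comm f g n = begin
    Σ< (suc n) (λ k → f k * g (n ∸ k))               ≈⟨ Σ-reverse (suc n) _ ⟩
    Σ< (suc n) (λ i → f (n ∸ i) * g (n ∸ (n ∸ i)))
      ≈⟨ Σ-cong (suc n) (λ i i<1+n → trans (*-comm _ _) (*-congʳ (≡-cong g (ℕP.m∸[m∸n]≡n (ℕP.<⇒≤pred i<1+n))))) ⟩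
    Σ< (suc n) (λ i → g i * f (n ∸ i))               ∎

  -- Associativity: both sides are the triangular double sum Σ_{j+l+r=n} fⱼ gₗ hᵣ.
  ⊛-assoc : ∀ f g h → ((f ⊛ g) ⊛ h) ≋ (f ⊛ (g ⊛ h))
  ⊛-assoc f g h n = begin
    Σ< (suc n) (λ i → Σ< (suc i) (λ j → f j * g (i ∸ j)) * h (n ∸ i))
      ≈⟨ Σ-cong-∀ (suc n) (λ i → Σ-*ʳ (suc i) _ _) ⟩
    Σ< (suc n) (λ i → Σ< (suc i) (λ j → f j * g (i ∸ j) * h (n ∸ i)))
      ≈⟨ Σ-triangle (suc n) _ ⟩
    Σ< (suc n) (λ j → Σ< (suc n ∸ j) (λ l → f j * g (j ℕ.+ l ∸ j) * h (n ∸ (j ℕ.+ l))))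
      ≈⟨ Σ-cong (suc n) inner ⟩
    Σ< (suc n) (λ j → f j * Σ< (suc (n ∸ j)) (λ l → g l * h (n ∸ j ∸ l)))
      ∎
    where
    inner : ∀ j → j < suc n → Σ< (suc n ∸ j) (λ l → f j * g (j ℕ.+ l ∸ j) * h (n ∸ (j ℕ.+ l)))
                              ≈ f j * Σ< (suc (n ∸ j)) (λ l → g l * h (n ∸ j ∸ l))
    inner j (s≤s j≤n) = begin
      Σ< (suc n ∸ j) (λ l → f j * g (j ℕ.+ l ∸ j) * h (n ∸ (j ℕ.+ l)))
        ≈⟨ ≡-cong (λ k → Σ< k (λ l → f j * g (j ℕ.+ l ∸ j) * h (n ∸ (j ℕ.+ l)))) (ℕP.+-∸-assoc 1 j≤n) ⟩
      Σ< (suc (n ∸ j)) (λ l → f j * g (j ℕ.+ l ∸ j) * h (n ∸ (j ℕ.+ l)))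
        ≈⟨ Σ-cong-∀ (suc (n ∸ j)) (λ l → trans (*-assoc _ _ _)
             (*-congˡ (*-cong (≡-cong g (ℕP.m+n∸m≡n j l)) (≡-cong h (P.sym (ℕP.∸-+-assoc n j l)))))) ⟩
      Σ< (suc (n ∸ j)) (λ l → f j * (g l * h (n ∸ j ∸ l)))
        ≈⟨ sym (Σ-*ˡ (suc (n ∸ j)) _ _) ⟩
      f j * Σ< (suc (n ∸ j)) (λ l → g l * h (n ∸ j ∸ l))
        ∎

  ⊛-identityʳ : ∀ f → (f ⊛ one) ≋ f
  ⊛-identityʳ f n = begin
    Σ< n (λ k → f k * one (n ∸ k)) + f n * one (n ∸ n)
      ≈⟨ +-cong (Σ-zero n _ (λ k k<n → trans (*-congˡ (≡-cong one (∸-suc n k k<n))) (zeroʳ _)))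
                (*-congˡ (≡-cong one (ℕP.n∸n≡0 n))) ⟩
    0# + f n * 1#  ≈⟨ trans (+-identityˡ _) (*-identityʳ _) ⟩
    f n            ∎

  ⊛-interchange : ∀ f g h k → ((f ⊛ g) ⊛ (h ⊛ k)) ≋ ((f ⊛ h) ⊛ (g ⊛ k))
  ⊛-interchange f g h k =
    ≋-trans (⊛-assoc f g (h ⊛ k))
    (≋-trans (⊛-cong {f = f} ≋-refl (≋-sym (⊛-assoc g h k)))
    (≋-trans (⊛-cong {f = f} ≋-refl (⊛-cong {g = k} (⊛-comm g h) ≋-refl))
    (≋-trans (⊛-cong {f = f} ≋-refl (⊛-assoc h g k))
             (≋-sym (⊛-assoc f h (g ⊛ k))))))

  spow-+ : ∀ w i j → spow w (i ℕ.+ j) ≋ (spow w i ⊛ spow w j)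
  spow-+ w i zero n = trans (≡-cong (λ k → spow w k n) (ℕP.+-identityʳ i)) (sym (⊛-identityʳ (spow w i) n))
  spow-+ w i (suc j) n = begin
    spow w (i ℕ.+ suc j) n             ≈⟨ ≡-cong (λ k → spow w k n) (ℕP.+-suc i j) ⟩
    (spow w (i ℕ.+ j) ⊛ w) n           ≈⟨ ⊛-cong {g = w} (spow-+ w i j) ≋-refl n ⟩
    ((spow w i ⊛ spow w j) ⊛ w) n      ≈⟨ ⊛-assoc (spow w i) (spow w j) w n ⟩
    (spow w i ⊛ spow w (suc j)) n      ∎

  spow-vanish : ∀ w → w 0 ≈ 0# → ∀ m n → n < m → spow w m n ≈ 0#
  spow-vanish w w0≈0 (suc m) n (s≤s n≤m) = Σ-zero (suc n) _ term-vanishes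
    where
    term-vanishes : ∀ k → k < suc n → spow w m k * w (n ∸ k) ≈ 0#
    term-vanishes k (s≤s k≤n) with k ℕP.<? m
    ... | yes k<m = trans (*-congʳ (spow-vanish w w0≈0 m k k<m)) (zeroˡ _)
    ... | no k≮m = trans
      (*-congˡ (trans (≡-cong w (ℕP.m≤n⇒m∸n≡0 (ℕP.≤-trans n≤m (ℕP.≮⇒≥ k≮m)))) w0≈0))
      (zeroʳ _)

  subst-range : ∀ w → w 0 ≈ 0# → ∀ a n N → n ≤ N → subst a w n ≈ Σ< (suc N) (λ m → a m * spow w m n)
  subst-range w w0≈0 a n N n≤N = sym (Σ-truncate (suc N) _ (s≤s n≤N)
    (λ m n<m _ → trans (*-congˡ (spow-vanish w w0≈0 m n n<m)) (zeroʳ _)))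

  subst-cong : ∀ w a b → (∀ m → a m ≈ b m) → subst a w ≋ subst b w
  subst-cong w a b a≈b n = Σ-cong-∀ (suc n) (λ m → *-congʳ (a≈b m))

  -- The double sum Σ_{i,j ≤ n} aᵢ bⱼ [tⁿ] w^{i+j}, to which both sides of the
  -- multiplicativity of substitution reduce.
  pairedSum : (a b : ℕ → Carrier) → Series → ℕ → Carrier
  pairedSum a b w n = Σ< (suc n) (λ i → Σ< (suc n) (λ j → (a i * b j) * spow w (i ℕ.+ j) n))

  -- Expanding both factors over the common range m ≤ n and collecting
  -- wⁱ ⊛ wʲ = w^{i+j} gives the paired sum.
  product-of-substs : ∀ w → w 0 ≈ 0# → ∀ a b n → (subst a w ⊛ subst b w) n ≈ pairedSum a b w n
  product-of-substs w w0≈0 a b n = begin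
    Σ< (suc n) (λ k → subst a w k * subst b w (n ∸ k))
      ≈⟨ Σ-cong (suc n) (λ k k<1+n → *-cong (subst-range w w0≈0 a k n (ℕP.<⇒≤pred k<1+n))
                                             (subst-range w w0≈0 b (n ∸ k) n (ℕP.m∸n≤m n k))) ⟩
    Σ< (suc n) (λ k → Σ< (suc n) (λ i → a i * W i k) * Σ< (suc n) (λ j → b j * W j (n ∸ k)))
      ≈⟨ Σ-cong-∀ (suc n) (λ k → Σ-*-Σ (suc n) (suc n) _ _) ⟩
    Σ< (suc n) (λ k → Σ< (suc n) (λ i → Σ< (suc n) (λ j → (a i * W i k) * (b j * W j (n ∸ k)))))
      ≈⟨ trans (Σ-swap (suc n) (suc n) _) (Σ-cong-∀ (suc n) (λ i → Σ-swap (suc n) (suc n) _)) ⟩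
    Σ< (suc n) (λ i → Σ< (suc n) (λ j → Σ< (suc n) (λ k → (a i * W i k) * (b j * W j (n ∸ k)))))
      ≈⟨ Σ-cong-∀ (suc n) (λ i → Σ-cong-∀ (suc n) (λ j → factor-out i j)) ⟩
    pairedSum a b w n ∎
    where
    W : ℕ → Series
    W = spow w
    factor-out : ∀ i j → Σ< (suc n) (λ k → (a i * W i k) * (b j * W j (n ∸ k))) ≈ (a i * b j) * W (i ℕ.+ j) n
    factor-out i j = begin
      Σ< (suc n) (λ k → (a i * W i k) * (b j * W j (n ∸ k)))
        ≈⟨ Σ-cong-∀ (suc n) (λ k → solve 4 (λ A B X Y → (A :* X) :* (B :* Y) := (A :* B) :* (X :* Y))
                                            refl (a i) (b j) (W i k) (W j (n ∸ k))) ⟩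
      Σ< (suc n) (λ k → (a i * b j) * (W i k * W j (n ∸ k)))  ≈⟨ sym (Σ-*ˡ (suc n) _ _) ⟩
      (a i * b j) * (W i ⊛ W j) n                              ≈⟨ *-congˡ (sym (spow-+ w i j n)) ⟩
      (a i * b j) * W (i ℕ.+ j) n                              ∎

  -- Re-indexing the convolution (i, m-i) as (i, l) and dropping the powers
  -- w^{i+l} with i + l > n gives the paired sum.
  subst-of-product : ∀ w → w 0 ≈ 0# → ∀ a b n → subst (a ⊛ b) w n ≈ pairedSum a b w n
  subst-of-product w w0≈0 a b n = begin
    Σ< (suc n) (λ m → Σ< (suc m) (λ i → a i * b (m ∸ i)) * W m n)
      ≈⟨ Σ-cong-∀ (suc n) (λ m → Σ-*ʳ (suc m) _ _) ⟩
    Σ< (suc n) (λ m → Σ< (suc m) (λ i → a i * b (m ∸ i) * W m n))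
      ≈⟨ Σ-triangle (suc n) _ ⟩
    Σ< (suc n) (λ i → Σ< (suc n ∸ i) (λ l → a i * b (i ℕ.+ l ∸ i) * W (i ℕ.+ l) n))
      ≈⟨ Σ-cong-∀ (suc n) (λ i → Σ-cong-∀ (suc n ∸ i) (λ l → *-congʳ (*-congˡ (≡-cong b (ℕP.m+n∸m≡n i l))))) ⟩
    Σ< (suc n) (λ i → Σ< (suc n ∸ i) (λ l → a i * b l * W (i ℕ.+ l) n))
      ≈⟨ Σ-cong-∀ (suc n) (λ i → sym (Σ-truncate (suc n) _ (ℕP.m∸n≤m (suc n) i) (high-powers-vanish i))) ⟩
    pairedSum a b w n ∎
    where
    W : ℕ → Series
    W = spow w
    high-powers-vanish : ∀ i l → suc n ∸ i ≤ l → l < suc n → a i * b l * W (i ℕ.+ l) n ≈ 0#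
    high-powers-vanish i l 1+n-i≤l _ = trans
      (*-congˡ (spow-vanish w w0≈0 (i ℕ.+ l) n (ℕP.≤-trans (ℕP.m≤n+m∸n (suc n) i) (ℕP.+-monoʳ-≤ i 1+n-i≤l))))
      (zeroʳ _)

  subst-⊛ : ∀ w → w 0 ≈ 0# → ∀ a b → (subst a w ⊛ subst b w) ≋ subst (a ⊛ b) w
  subst-⊛ w w0≈0 a b n = trans (product-of-substs w w0≈0 a b n) (sym (subst-of-product w w0≈0 a b n))

  Π-cong : ∀ n {f g : ℕ → Carrier} → (∀ i → f i ≈ g i) → Π< n f ≈ Π< n g
  Π-cong zero f≈g = refl
  Π-cong (suc n) f≈g = *-cong (Π-cong n f≈g) (f≈g n)

  gbinom-cong : ∀ {x y} → x ≈ y → ∀ j → gbinom x j ≈ gbinom y j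
  gbinom-cong x≈y j = *-congʳ (Π-cong j (λ i → +-congʳ x≈y))

  gbinom-zero : ∀ x → gbinom x 0 ≈ 1#
  gbinom-zero x = trans (*-identityˡ _)
    (sym (inverse-unique (fromℕ 1) 1# (charZero 0) (trans (*-identityʳ _) (+-identityʳ _))))

  factorial-inverse-step : ∀ m → fromℕ (suc m !) ⁻¹ * fromℕ (suc m) ≈ fromℕ (m !) ⁻¹
  factorial-inverse-step m = inverse-unique m! (M! ⁻¹ * M) (factorial-nonzero m) (begin
      m! * (M! ⁻¹ * M)  ≈⟨ solve 3 (λ P Q S → P :* (Q :* S) := (S :* P) :* Q) refl m! (M! ⁻¹) M ⟩
      (M * m!) * M! ⁻¹  ≈⟨ *-congʳ (sym (fromℕ-* (suc m) (m !))) ⟩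
      M! * M! ⁻¹        ≈⟨ ⁻¹-inverse M! (factorial-nonzero (suc m)) ⟩
      1#                ∎)
    where
    m! M! M : Carrier
    m! = fromℕ (m !)
    M! = fromℕ (suc m !)
    M = fromℕ (suc m)

  gbinom-suc : ∀ x m → gbinom x (suc m) * fromℕ (suc m) ≈ gbinom x m * (x - fromℕ m)
  gbinom-suc x m = begin
    (p * d) * fromℕ (suc m !) ⁻¹ * fromℕ (suc m)    ≈⟨ *-assoc _ _ _ ⟩
    (p * d) * (fromℕ (suc m !) ⁻¹ * fromℕ (suc m))  ≈⟨ *-congˡ (factorial-inverse-step m) ⟩
    (p * d) * fromℕ (m !) ⁻¹
      ≈⟨ solve 3 (λ A B C → (A :* B) :* C := (A :* C) :* B) refl p d (fromℕ (m !) ⁻¹) ⟩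
    p * fromℕ (m !) ⁻¹ * d                           ∎
    where
    p d : Carrier
    p = Π< m (λ i → x - fromℕ i)
    d = x - fromℕ m

  -- The two halves of (m+1)·Σₖ C(a,k) C(b,m+1-k), split as (m+1) = k + (m+1-k):
  -- after applying the recurrence to each factor, the summation index shifts by one.
  weighted-left : ∀ a (g : ℕ → Carrier) m →
    Σ< (suc (suc m)) (λ k → (gbinom a k * fromℕ k) * g (suc m ∸ k))
      ≈ Σ< (suc m) (λ k → (gbinom a k * (a - fromℕ k)) * g (m ∸ k))
  weighted-left a g m = begin
    Σ< (suc (suc m)) (λ k → (gbinom a k * fromℕ k) * g (suc m ∸ k))
      ≈⟨ Σ-head (suc m) _ ⟩
    (gbinom a 0 * 0#) * g (suc m) + Σ< (suc m) (λ k → (gbinom a (suc k) * fromℕ (suc k)) * g (m ∸ k))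
      ≈⟨ +-cong (trans (*-congʳ (zeroʳ _)) (zeroˡ _)) (Σ-cong-∀ (suc m) (λ k → *-congʳ (gbinom-suc a k))) ⟩
    0# + Σ< (suc m) (λ k → (gbinom a k * (a - fromℕ k)) * g (m ∸ k))
      ≈⟨ +-identityˡ _ ⟩
    Σ< (suc m) (λ k → (gbinom a k * (a - fromℕ k)) * g (m ∸ k)) ∎

  weighted-right : ∀ b (f : ℕ → Carrier) m →
    Σ< (suc (suc m)) (λ k → f k * (gbinom b (suc m ∸ k) * fromℕ (suc m ∸ k)))
      ≈ Σ< (suc m) (λ k → f k * (gbinom b (m ∸ k) * (b - fromℕ (m ∸ k))))
  weighted-right b f m = begin
    Σ< (suc m) (λ k → f k * (gbinom b (suc m ∸ k) * fromℕ (suc m ∸ k)))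
      + f (suc m) * (gbinom b (m ∸ m) * fromℕ (m ∸ m))
      ≈⟨ +-cong (Σ-cong (suc m) shift) last-vanishes ⟩
    Σ< (suc m) (λ k → f k * (gbinom b (m ∸ k) * (b - fromℕ (m ∸ k)))) + 0#
      ≈⟨ +-identityʳ _ ⟩
    Σ< (suc m) (λ k → f k * (gbinom b (m ∸ k) * (b - fromℕ (m ∸ k)))) ∎
    where
    last-vanishes : f (suc m) * (gbinom b (m ∸ m) * fromℕ (m ∸ m)) ≈ 0#
    last-vanishes = trans (*-congˡ (trans (≡-cong (λ t → gbinom b t * fromℕ t) (ℕP.n∸n≡0 m)) (zeroʳ _))) (zeroʳ _)
    shift : ∀ k → k < suc m → f k * (gbinom b (suc m ∸ k) * fromℕ (suc m ∸ k))
                              ≈ f k * (gbinom b (m ∸ k) * (b - fromℕ (m ∸ k)))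
    shift k (s≤s k≤m) = *-congˡ (trans (≡-cong (λ t → gbinom b t * fromℕ t) (ℕP.+-∸-assoc 1 k≤m)) (gbinom-suc b (m ∸ k)))

  neg-fromℕ-split : ∀ k M → k ≤ M → - fromℕ k + - fromℕ (M ∸ k) ≈ - fromℕ M
  neg-fromℕ-split k M k≤M = trans (⁻¹-∙-comm _ _) (-‿cong (sym (fromℕ-split k M k≤M)))

  convolution-suc : ∀ a b m →
    (gbinom a ⊛ gbinom b) (suc m) * fromℕ (suc m) ≈ (gbinom a ⊛ gbinom b) m * ((a + b) - fromℕ m)
  convolution-suc a b m = begin
    Σ< (suc M) (λ k → A k * B (M ∸ k)) * fromℕ M     ≈⟨ Σ-*ʳ (suc M) _ _ ⟩
    Σ< (suc M) (λ k → A k * B (M ∸ k) * fromℕ M)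
      ≈⟨ Σ-cong (suc M) (λ k k<1+M → trans (*-congˡ (fromℕ-split k M (ℕP.<⇒≤pred k<1+M)))
           (solve 4 (λ X Y K L → X :* Y :* (K :+ L) := (X :* K) :* Y :+ X :* (Y :* L)) refl
                    (A k) (B (M ∸ k)) (fromℕ k) (fromℕ (M ∸ k)))) ⟩
    Σ< (suc M) (λ k → (A k * fromℕ k) * B (M ∸ k) + A k * (B (M ∸ k) * fromℕ (M ∸ k)))
      ≈⟨ Σ-+ (suc M) _ _ ⟩
    Σ< (suc M) (λ k → (A k * fromℕ k) * B (M ∸ k)) + Σ< (suc M) (λ k → A k * (B (M ∸ k) * fromℕ (M ∸ k)))
      ≈⟨ +-cong (weighted-left a B m) (weighted-right b A m) ⟩
    Σ< M (λ k → (A k * (a - fromℕ k)) * B (m ∸ k)) + Σ< M (λ k → A k * (B (m ∸ k) * (b - fromℕ (m ∸ k))))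
      ≈⟨ sym (Σ-+ M _ _) ⟩
    Σ< M (λ k → (A k * (a - fromℕ k)) * B (m ∸ k) + A k * (B (m ∸ k) * (b - fromℕ (m ∸ k))))
      ≈⟨ Σ-cong M (λ k k<M → trans
           (solve 6 (λ X Y α β K L → X :* (α :+ K) :* Y :+ X :* (Y :* (β :+ L))
                                   := (X :* Y) :* ((α :+ β) :+ (K :+ L)))
                    refl (A k) (B (m ∸ k)) a b (- fromℕ k) (- fromℕ (m ∸ k)))
           (*-congˡ (+-congˡ (neg-fromℕ-split k m (ℕP.<⇒≤pred k<M))))) ⟩
    Σ< M (λ k → (A k * B (m ∸ k)) * ((a + b) - fromℕ m))  ≈⟨ sym (Σ-*ʳ M _ _) ⟩
    Σ< M (λ k → A k * B (m ∸ k)) * ((a + b) - fromℕ m)    ∎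
    where
    M : ℕ
    M = suc m
    A B : ℕ → Carrier
    A = gbinom a
    B = gbinom b

  -- Chu–Vandermonde: Σₖ C(a,k) C(b,m-k) = C(a+b,m), by induction on m,
  -- since both sides satisfy the same recurrence and (m+1) ≠ 0.
  vandermonde : ∀ a b m → (gbinom a ⊛ gbinom b) m ≈ gbinom (a + b) m
  vandermonde a b zero = begin
    0# + gbinom a 0 * gbinom b 0  ≈⟨ +-identityˡ _ ⟩
    gbinom a 0 * gbinom b 0       ≈⟨ trans (*-cong (gbinom-zero a) (gbinom-zero b)) (*-identityˡ _) ⟩
    1#                            ≈⟨ sym (gbinom-zero (a + b)) ⟩
    gbinom (a + b) 0              ∎
  vandermonde a b (suc m) = *-cancelʳ (fromℕ (suc m)) _ _ (charZero m) (begin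
    (gbinom a ⊛ gbinom b) (suc m) * fromℕ (suc m)   ≈⟨ convolution-suc a b m ⟩
    (gbinom a ⊛ gbinom b) m * ((a + b) - fromℕ m)   ≈⟨ *-congʳ (vandermonde a b m) ⟩
    gbinom (a + b) m * ((a + b) - fromℕ m)          ≈⟨ sym (gbinom-suc (a + b) m) ⟩
    gbinom (a + b) (suc m) * fromℕ (suc m)          ∎)

  pow-+ : ∀ x i j → pow x (i ℕ.+ j) ≈ pow x i * pow x j
  pow-+ x i zero = trans (≡-cong (pow x) (ℕP.+-identityʳ i)) (sym (*-identityʳ _))
  pow-+ x i (suc j) = trans (≡-cong (pow x) (ℕP.+-suc i j)) (trans (*-congʳ (pow-+ x i j)) (*-assoc _ _ _))

  onePlusPow-cong : ∀ α {x y} → x ≈ y → onePlusPow α x ≋ onePlusPow α y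
  onePlusPow-cong α x≈y j = *-congʳ (gbinom-cong (*-congʳ x≈y) j)

  -- (1+αt)^{x/α} (1+αt)^{y/α} = (1+αt)^{(x+y)/α}: the coefficient αⁿ factors
  -- out of the Cauchy product, leaving Vandermonde for x/α and y/α.
  onePlusPow-⊛ : ∀ α x y → (onePlusPow α x ⊛ onePlusPow α y) ≋ onePlusPow α (x + y)
  onePlusPow-⊛ α x y n = begin
    Σ< (suc n) (λ k → (gbinom u k * pow α k) * (gbinom v (n ∸ k) * pow α (n ∸ k)))
      ≈⟨ Σ-cong (suc n) (λ k k<1+n → trans
           (solve 4 (λ A B C D → (A :* C) :* (B :* D) := (A :* B) :* (C :* D)) refl
                    (gbinom u k) (gbinom v (n ∸ k)) (pow α k) (pow α (n ∸ k)))
           (*-congˡ (trans (sym (pow-+ α k (n ∸ k))) (≡-cong (pow α) (ℕP.m+[n∸m]≡n (ℕP.<⇒≤pred k<1+n)))))) ⟩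
    Σ< (suc n) (λ k → (gbinom u k * gbinom v (n ∸ k)) * pow α n)  ≈⟨ sym (Σ-*ʳ (suc n) _ _) ⟩
    (gbinom u ⊛ gbinom v) n * pow α n                             ≈⟨ *-congʳ (vandermonde u v n) ⟩
    gbinom (u + v) n * pow α n
      ≈⟨ *-congʳ (gbinom-cong (sym (distribʳ (α ⁻¹) x y)) n) ⟩
    gbinom ((x + y) * α ⁻¹) n * pow α n                           ∎
    where
    u v : Carrier
    u = x * α ⁻¹
    v = y * α ⁻¹

  -- g^{λ₁} g^{λ₂} = g^{λ₁+λ₂} for g with constant term 1: substitution of
  -- g - 1 is multiplicative, and the binomial coefficients convolve by Vandermonde.
  gpow-⊛ : ∀ g → g 0 ≈ 1# → ∀ λ₁ λ₂ → (gpow g λ₁ ⊛ gpow g λ₂) ≋ gpow g (λ₁ + λ₂)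
  gpow-⊛ g g0≈1 λ₁ λ₂ =
    ≋-trans (subst-⊛ (g ⊖ one) (trans (+-congʳ g0≈1) (-‿inverseʳ 1#)) _ _)
            (subst-cong (g ⊖ one) _ _ (vandermonde λ₁ λ₂))

  recip-constant : ∀ h → recip h 0 ≈ 1#
  recip-constant h = trans (+-identityˡ _) (*-identityˡ _)

  genFun-⊛ : ∀ α β λ₁ λ₂ x y →
    (genFun λ₁ α β x ⊛ genFun λ₂ α β y) ≋ genFun (λ₁ + λ₂) α β (x + y)
  genFun-⊛ α β λ₁ λ₂ x y =
    ≋-trans (⊛-interchange (gpow R λ₁) (onePlusPow α x) (gpow R λ₂) (onePlusPow α y))
            (⊛-cong (gpow-⊛ R (recip-constant half-sum) λ₁ λ₂) (onePlusPow-⊛ α x y))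
    where
    half-sum R : Series
    half-sum = scale (fromℕ 2 ⁻¹) (onePlusPow α β ⊕ one)
    R = recip half-sum

  genFun-cong : ∀ λ′ α β {x y} → x ≈ y → genFun λ′ α β x ≋ genFun λ′ α β y
  genFun-cong λ′ α β x≈y = ⊛-cong ≋-refl (onePlusPow-cong α x≈y)

  binomial-convolution : ∀ (f g : Series) n →
    Σ< (suc n) (λ k → fromℕ (n C k) * (fromℕ (k !) * f k) * (fromℕ ((n ∸ k) !) * g (n ∸ k)))
      ≈ fromℕ (n !) * (f ⊛ g) n
  binomial-convolution f g n = begin
    Σ< (suc n) (λ k → fromℕ (n C k) * (fromℕ (k !) * f k) * (fromℕ ((n ∸ k) !) * g (n ∸ k)))
      ≈⟨ Σ-cong (suc n) (λ k k<1+n → term k (ℕP.<⇒≤pred k<1+n)) ⟩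
    Σ< (suc n) (λ k → fromℕ (n !) * (f k * g (n ∸ k)))  ≈⟨ sym (Σ-*ˡ (suc n) _ _) ⟩
    fromℕ (n !) * (f ⊛ g) n                               ∎
    where
    term : ∀ k → k ≤ n → fromℕ (n C k) * (fromℕ (k !) * f k) * (fromℕ ((n ∸ k) !) * g (n ∸ k))
                          ≈ fromℕ (n !) * (f k * g (n ∸ k))
    term k k≤n = begin
      fromℕ (n C k) * (fromℕ (k !) * f k) * (fromℕ ((n ∸ k) !) * g (n ∸ k))
        ≈⟨ solve 5 (λ C P Q u v → C :* (P :* u) :* (Q :* v) := (C :* (P :* Q)) :* (u :* v)) refl
                   (fromℕ (n C k)) (fromℕ (k !)) (fromℕ ((n ∸ k) !)) (f k) (g (n ∸ k)) ⟩
      (fromℕ (n C k) * (fromℕ (k !) * fromℕ ((n ∸ k) !))) * (f k * g (n ∸ k))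
        ≈⟨ *-congʳ (sym (trans (fromℕ-* (n C k) _) (*-congˡ (fromℕ-* (k !) _)))) ⟩
      fromℕ ((n C k) ℕ.* (k ! ℕ.* (n ∸ k) !)) * (f k * g (n ∸ k))
        ≈⟨ *-congʳ (≡-cong fromℕ (binomial-factorials n k k≤n)) ⟩
      fromℕ (n !) * (f k * g (n ∸ k))
        ∎

  -- The theorem: n! times the n-th coefficient of the product law, with
  -- x₁ + γ₂ = α + γ₁ + γ₂ - β.
  euler-convolution : ∀ (α β γ₁ γ₂ λ₁ λ₂ : Carrier) → ¬ (α ≈ 0#) → ∀ (n : ℕ) →
    Σ< (suc n) (λ k → fromℕ (n C k) * E λ₁ α β (α + γ₁ - β) k * E λ₂ α β γ₂ (n ∸ k))
      ≈ E (λ₁ + λ₂) α β (α + γ₁ + γ₂ - β) n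
  euler-convolution α β γ₁ γ₂ λ₁ λ₂ _ n = begin
    Σ< (suc n) (λ k → fromℕ (n C k) * E λ₁ α β x₁ k * E λ₂ α β γ₂ (n ∸ k))
      ≈⟨ binomial-convolution (genFun λ₁ α β x₁) (genFun λ₂ α β γ₂) n ⟩
    fromℕ (n !) * (genFun λ₁ α β x₁ ⊛ genFun λ₂ α β γ₂) n
      ≈⟨ *-congˡ (genFun-⊛ α β λ₁ λ₂ x₁ γ₂ n) ⟩
    fromℕ (n !) * genFun (λ₁ + λ₂) α β (x₁ + γ₂) n
      ≈⟨ *-congˡ (genFun-cong (λ₁ + λ₂) α β regroup n) ⟩
    E (λ₁ + λ₂) α β (α + γ₁ + γ₂ - β) n
      ∎
    where
    x₁ : Carrier
    x₁ = α + γ₁ - β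
    regroup : x₁ + γ₂ ≈ α + γ₁ + γ₂ - β
    regroup = solve 4 (λ a g₁ g₂ nb → (a :+ g₁ :+ nb) :+ g₂ := a :+ g₁ :+ g₂ :+ nb) refl α γ₁ γ₂ (- β)

mainTheorem11 : ∀ {c ℓ : Level} (F : CharZeroField c ℓ) →
    let open CharZeroField F in let open Euler F in
    ∀ (α β γ₁ γ₂ λ₁ λ₂ : Carrier) → ¬ (α ≈ 0#) → ∀ (n : ℕ) →
    Σ< ((suc n)) (λ k → fromℕ (n C k) * E λ₁ α β (α + γ₁ - β) k * E λ₂ α β γ₂ (n ∸ k))
    ≈ E (λ₁ + λ₂) α β (α + γ₁ + γ₂ - β) n
mainTheorem11 F = EulerConvolution.euler-convolution F
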